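{- Let $\Delta$ be a finite set of formulas of $\mathrm{PRED2}_0$ and $\varphi$ a formula of $\mathrm{PRED2}_0$. If $\Delta\vdash_{\mathrm{PRED2}_0}\varphi$, then $\langle\Delta\rangle,\Gamma(\Delta\cup\{\varphi\})\vdash_{\mathcal{I}_0}\langle\varphi\rangle$.
   Context: $\mathrm{PRED2}_0$: fix a finite set $\mathcal{B}$ of base types; types are $\mathcal{T}::= o\mid \beta\mid \beta\to\tau$ with $\beta\in\mathcal{B}$, $\tau\in\mathcal{T}$. For each type $\tau$ there is a countable set $V_\tau$ of variables (each variable has a unique type) and a countable set $\Sigma_\tau$ of constants. Terms of type $\tau$ ($T_\tau$): variables in $V_\tau$, constants in $\Sigma_\tau$, and applications $t\,s$ with $t\in T_{\sigma\to\tau}$, $s\in T_\sigma$, $\sigma\in\mathcal{B}$; formulas ($T_o$) additionally include $\varphi\supset\psi$ for $\varphi,\psi\in T_o$ and $\forall x.\varphi$ for $x\in V_\tau$, $\tau\in\mathcal{B}\cup\{o\}$, $\varphi\in T_o$. Formulas are identified up to $\alpha$-equivalence; $\varphi[x/t]$ is capture-avoiding substitution. Derivability $\Delta\vdash\varphi$ ($\Delta$ finite): axiom $\Delta,\varphi\vdash\varphi$; from $\Delta,\varphi\vdash\psi$ infer $\Delta\vdash\varphi\supset\psi$; from $\Delta\vdash\varphi\supset\psi$ and $\Delta\vdash\varphi$ infer $\Delta\vdash\psi$; from $\Delta\vdash\varphi$ infer $\Delta\vdash\forall x.\varphi$ if $x$ is not free in $\Delta$; from $\Delta\vdash\forall x.\varphi$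 with $x\in V_\tau$ infer $\Delta\vdash\varphi[x/t]$ for any $t\in T_\tau$. $\mathcal{I}_0$: terms are type-free $\lambda$-terms over a constant set $\Sigma$ containing $\Xi$, $L$, $A_\tau$ for each $\tau\in\mathcal{B}$, and every constant of every $\Sigma_\tau$; all variables of $\mathrm{PRED2}_0$ are variables of $\mathcal{I}_0$. Abbreviations: $K\equiv\lambda xy.x$, $H\equiv\lambda x.L(Kx)$, $t_1\supset t_2\equiv(\lambda xy.\Xi(Kx)(Ky))t_1t_2$, $F\equiv\lambda xyf.\Xi x(\lambda z.y(fz))$. Judgements $\Gamma\vdash t$ with $\Gamma$ a finite set of terms; axioms $\Gamma,t\vdash t$; $\Gamma\vdash LH$; $\Gamma\vdash LA_\tau$ ($\tau\in\mathcal{B}$); rules: from $\Gamma\vdash t_1$, $t_1=_{\beta\eta}t_2$ infer $\Gamma\vdash t_2$; from $\Gamma\vdash t$ infer $\Gamma\vdash Ht$; from $\Gamma\vdash\Xi t_1t_2$ and $\Gamma\vdash t_1t_3$ infer $\Gamma\vdash t_2t_3$; from $\Gamma,t_1x\vdash t_2x$ and $\Gamma\vdash Lt_1$ infer $\Gamma\vdash\Xi t_1t_2$; from $\Gamma,t_1x\vdash H(t_2x)$ and $\Gamma\vdash Lt_1$ infer $\Gamma\vdash H(\Xi t_1t_2)$; in the last two $x$ is not free in $\Gamma,t_1,t_2$. For an arbitrary set $\Gamma$, $\Gamma\vdash_{\mathcal{I}_0}t$ means $\Gamma'\vdash t$ is derivable for some finite $\Gamma'\subseteq\Gamma$. Translation: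 set $A_o\equiv H$ and $A_{\tau_1\to\tau_2}\equiv F A_{\tau_1}A_{\tau_2}$. Define $\langle x\rangle=x$, $\langle c\rangle=c$, $\langle t_1t_2\rangle=\langle t_1\rangle\langle t_2\rangle$, $\langle\varphi\supset\psi\rangle=\langle\varphi\rangle\supset\langle\psi\rangle$, $\langle\forall x.\varphi\rangle=\Xi A_\tau(\lambda x.\langle\varphi\rangle)$ for $x\in V_\tau$; $\langle\Delta\rangle$ is the image of $\Delta$. For a finite set of formulas $\Delta$, $\Gamma(\Delta)$ consists of: $A_\tau x$ for every variable $x\in V_\tau$ free in $\Delta$; $A_\tau c$ for every type $\tau$ and every $c\in\Sigma_\tau$; $LA_\tau$ for every $\tau\in\mathcal{B}$; and for every $\tau\in\mathcal{B}$, $A_\tau y$ for some chosen variable $y\in V_\tau$ not free in $\Delta$. -}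

module Defs where

open import Data.Nat using (ℕ; zero; suc)
import Data.Nat as N
open import Data.Fin using (Fin; zero; suc)
import Data.Fin as F
open import Data.List using (List; []; _∷_; length)
open import Data.List.Membership.Propositional using (_∈_)
open import Data.List.Relation.Unary.All using (All)
open import Data.Product using (Σ; _×_; _,_)
open import Data.Sum using (_⊎_)
open import Relation.Binary.PropositionalEquality using (_≡_; refl; cong; cong₂)
open import Relation.Nullary using (¬_; Dec; yes; no)

-- PRED2_0 : types over a finite set of base types  B = Fin k

data Ty (k : ℕ) : Set where
  o    : Ty k
  base : Fin k → Ty k
  _⇒_  : Fin k → Ty k → Ty k

infixr 5 _⇒_

_≟Ty_ : ∀ {k} (σ τ : Ty k) → Dec (σ ≡ τ)
o ≟Ty o = yes refl
o ≟Ty base _ = no (λ ())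
o ≟Ty (_ ⇒ _) = no (λ ())
base _ ≟Ty o = no (λ ())
base β ≟Ty base γ with β F.≟ γ
... | yes refl = yes refl
... | no ne = no (λ { refl → ne refl })
base _ ≟Ty (_ ⇒ _) = no (λ ())
(_ ⇒ _) ≟Ty o = no (λ ())
(_ ⇒ _) ≟Ty base _ = no (λ ())
(β ⇒ σ) ≟Ty (γ ⇒ τ) with β F.≟ γ | σ ≟Ty τ
... | yes refl | yes refl = yes refl
... | no ne | _ = no (λ { refl → ne refl })
... | _ | no ne = no (λ { refl → ne refl })

-- types over which one may quantify: B ∪ {o}
data QTy {k : ℕ} : Ty k → Set where
  qo : QTy o
  qb : (β : Fin k) → QTy (base β)

data _∋_ {k : ℕ} : List (Ty k) → Ty k → Set where
  here  : ∀ {Γ τ} → (τ ∷ Γ) ∋ τ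
  there : ∀ {Γ τ σ} → Γ ∋ τ → (σ ∷ Γ) ∋ τ

-- Terms/formulas, locally nameless: free variables are named
-- (variable n of type τ is the n-th element of V_τ, V_τ ≅ ℕ),
-- bound variables are typed de Bruijn positions (so α-equivalent
-- formulas are literally equal).
module _ {k : ℕ} (Con : Ty k → Set) where
  data Tm (Γ : List (Ty k)) : Ty k → Set where
    var  : ∀ {τ} → ℕ → Tm Γ τ
    bvar : ∀ {τ} → Γ ∋ τ → Tm Γ τ
    con  : ∀ {τ} → Con τ → Tm Γ τ
    app  : ∀ {β τ} → Tm Γ (β ⇒ τ) → Tm Γ (base β) → Tm Γ τ
    imp  : Tm Γ o → Tm Γ o → Tm Γ o
    all  : ∀ {τ} → QTy τ → Tm (τ ∷ Γ) o → Tm Γ o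

  Form : Set
  Form = Tm [] o

module _ {k : ℕ} {Con : Ty k → Set} where

  Ren : List (Ty k) → List (Ty k) → Set
  Ren Γ Δ = ∀ {τ} → Γ ∋ τ → Δ ∋ τ

  extR : ∀ {Γ Δ σ} → Ren Γ Δ → Ren (σ ∷ Γ) (σ ∷ Δ)
  extR r here = here
  extR r (there i) = there (r i)

  ren : ∀ {Γ Δ τ} → Ren Γ Δ → Tm Con Γ τ → Tm Con Δ τ
  ren r (var n) = var n
  ren r (bvar i) = bvar (r i)
  ren r (con c) = con c
  ren r (app t s) = app (ren r t) (ren r s)
  ren r (imp φ ψ) = imp (ren r φ) (ren r ψ)
  ren r (all q φ) = all q (ren (extR r) φ)

  record Sub (Γ Δ : List (Ty k)) : Set where
    field
      ρ : ∀ {τ} → Γ ∋ τ → Tm Con Δ τ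
      ν : (τ : Ty k) → ℕ → Tm Con Δ τ
  open Sub

  extS : ∀ {Γ Δ σ} → Sub Γ Δ → Sub (σ ∷ Γ) (σ ∷ Δ)
  ρ (extS s) here = bvar here
  ρ (extS s) (there i) = ren there (ρ s i)
  ν (extS s) τ n = ren there (ν s τ n)

  sub : ∀ {Γ Δ τ} → Sub Γ Δ → Tm Con Γ τ → Tm Con Δ τ
  sub s (var {τ} n) = ν s τ n
  sub s (bvar i) = ρ s i
  sub s (con c) = con c
  sub s (app t u) = app (sub s t) (sub s u)
  sub s (imp φ ψ) = imp (sub s φ) (sub s ψ)
  sub s (all q φ) = all q (sub (extS s) φ)

  inst : ∀ {τ} → Tm Con (τ ∷ []) o → Tm Con [] τ → Form Con
  inst {τ} φ t = sub s φ
    where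
    s : Sub (τ ∷ []) []
    ρ s here = t
    ρ s (there ())
    ν s σ n = var n

  -- abstracting the named variable (τ , n): ∀x.φ is  all q (close τ n φ)
  closeν : (τ : Ty k) → ℕ → (σ : Ty k) → ℕ → Tm Con (τ ∷ []) σ
  closeν τ n σ m with σ ≟Ty τ | m N.≟ n
  ... | yes refl | yes _ = bvar here
  ... | _ | _ = var m

  close : (τ : Ty k) → ℕ → Form Con → Tm Con (τ ∷ []) o
  close τ n φ = sub s φ
    where
    s : Sub [] (τ ∷ [])
    ρ s ()
    ν s σ m = closeν τ n σ m

  -- the variable (τ , n) occurs free (all named variables are free)
  data Occ (τ : Ty k) (n : ℕ) : ∀ {Γ σ} → Tm Con Γ σ → Set where
    o-var  : ∀ {Γ} → Occ τ n (var {Γ = Γ} {τ = τ} n)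
    o-appl : ∀ {Γ β σ} {t : Tm Con Γ (β ⇒ σ)} {u} → Occ τ n t → Occ τ n (app t u)
    o-appr : ∀ {Γ β σ} {t : Tm Con Γ (β ⇒ σ)} {u} → Occ τ n u → Occ τ n (app t u)
    o-impl : ∀ {Γ} {φ ψ : Tm Con Γ o} → Occ τ n φ → Occ τ n (imp φ ψ)
    o-impr : ∀ {Γ} {φ ψ : Tm Con Γ o} → Occ τ n ψ → Occ τ n (imp φ ψ)
    o-all  : ∀ {Γ σ} {q : QTy σ} {φ : Tm Con (σ ∷ Γ) o} → Occ τ n φ → Occ τ n (all q φ)

  FreeInList : Ty k → ℕ → List (Form Con) → Set
  FreeInList τ n Δ = Σ (Form Con) λ ψ → ψ ∈ Δ × Occ τ n ψ

  -- derivability in PRED2_0 (finite sets of formulas as lists)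
  infix 3 _⊢P_
  data _⊢P_ : List (Form Con) → Form Con → Set where
    ax  : ∀ {Δ φ} → φ ∈ Δ → Δ ⊢P φ
    ⊃I  : ∀ {Δ φ ψ} → (φ ∷ Δ) ⊢P ψ → Δ ⊢P imp φ ψ
    ⊃E  : ∀ {Δ φ ψ} → Δ ⊢P imp φ ψ → Δ ⊢P φ → Δ ⊢P ψ
    ∀I  : ∀ {Δ φ τ} (q : QTy τ) (n : ℕ) → ¬ FreeInList τ n Δ →
          Δ ⊢P φ → Δ ⊢P all q (close τ n φ)
    ∀E  : ∀ {Δ τ} {q : QTy τ} {φ : Tm Con (τ ∷ []) o} →
          Δ ⊢P all q φ → (t : Tm Con [] τ) → Δ ⊢P inst φ t

-- I_0 : type-free λ-terms (well-scoped de Bruijn for bound variables,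
-- named free variables = the variables (τ , n) of PRED2_0)

module _ {k : ℕ} (Con : Ty k → Set) where
  data ICon : Set where
    Ξ  : ICon
    L  : ICon
    A  : Fin k → ICon
    cc : ∀ {τ} → Con τ → ICon

  data Λ (m : ℕ) : Set where
    fv  : Ty k → ℕ → Λ m
    bv  : Fin m → Λ m
    cn  : ICon → Λ m
    _·_ : Λ m → Λ m → Λ m
    lam : Λ (suc m) → Λ m

  infixl 7 _·_

module _ {k : ℕ} {Con : Ty k → Set} where

  extRΛ : ∀ {m m'} → (Fin m → Fin m') → Fin (suc m) → Fin (suc m')
  extRΛ r zero = zero
  extRΛ r (suc i) = suc (r i)

  renΛ : ∀ {m m'} → (Fin m → Fin m') → Λ Con m → Λ Con m'
  renΛ r (fv τ n) = fv τ n
  renΛ r (bv i) = bv (r i)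
  renΛ r (cn c) = cn c
  renΛ r (t · u) = renΛ r t · renΛ r u
  renΛ r (lam t) = lam (renΛ (extRΛ r) t)

  extSΛ : ∀ {m m'} → (Fin m → Λ Con m') → Fin (suc m) → Λ Con (suc m')
  extSΛ s zero = bv zero
  extSΛ s (suc i) = renΛ suc (s i)

  subΛ : ∀ {m m'} → (Fin m → Λ Con m') → Λ Con m → Λ Con m'
  subΛ s (fv τ n) = fv τ n
  subΛ s (bv i) = s i
  subΛ s (cn c) = cn c
  subΛ s (t · u) = subΛ s t · subΛ s u
  subΛ s (lam t) = lam (subΛ (extSΛ s) t)

  β-sub : ∀ {m} → Λ Con m → Fin (suc m) → Λ Con m
  β-sub u zero = u
  β-sub u (suc i) = bv i

  infix 4 _=βη_
  data _=βη_ {m : ℕ} : Λ Con m → Λ Con m → Set where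
    βr    : ∀ {b u} → (lam b · u) =βη subΛ (β-sub u) b
    ηr    : ∀ {t} → lam (renΛ suc t · bv zero) =βη t
    refl' : ∀ {t} → t =βη t
    sym'  : ∀ {t u} → t =βη u → u =βη t
    trans' : ∀ {t u v} → t =βη u → u =βη v → t =βη v
    app-cong : ∀ {t t' u u'} → t =βη t' → u =βη u' → (t · u) =βη (t' · u')
    lam-cong : ∀ {t t' : Λ Con (suc m)} → t =βη t' → lam t =βη lam t'

  Ξ' L' : ∀ {m} → Λ Con m
  Ξ' = cn Ξ
  L' = cn L

  K : ∀ {m} → Λ Con m
  K = lam (lam (bv (suc zero)))

  H : ∀ {m} → Λ Con m
  H = lam (L' · (K · bv zero))

  _⊃'_ : ∀ {m} → Λ Con m → Λ Con m → Λ Con m   -- (λxy.Ξ(Kx)(Ky)) t1 t2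
  t₁ ⊃' t₂ = lam (lam (Ξ' · (K · bv (suc zero)) · (K · bv zero))) · t₁ · t₂

  Fc : ∀ {m} → Λ Con m                     -- λxyf.Ξx(λz.y(fz))
  Fc = lam (lam (lam (Ξ' · bv (suc (suc zero))
                         · lam (bv (suc (suc zero)) · (bv (suc zero) · bv zero)))))

  AT : ∀ {m} → Ty k → Λ Con m
  AT o = H
  AT (base β) = cn (A β)
  AT (β ⇒ τ) = Fc · AT (base β) · AT τ

  data OccΛ (τ : Ty k) (n : ℕ) : ∀ {m} → Λ Con m → Set where
    o-fv  : ∀ {m} → OccΛ τ n (fv {m = m} τ n)
    o-·l  : ∀ {m} {t u : Λ Con m} → OccΛ τ n t → OccΛ τ n (t · u)
    o-·r  : ∀ {m} {t u : Λ Con m} → OccΛ τ n u → OccΛ τ n (t · u)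
    o-lam : ∀ {m} {t : Λ Con (suc m)} → OccΛ τ n t → OccΛ τ n (lam t)

  Λ₀ : Set
  Λ₀ = Λ Con 0

  FreshIn : Ty k → ℕ → List Λ₀ → Set
  FreshIn τ n Γ = ∀ t → t ∈ Γ → ¬ OccΛ τ n t

  infix 3 _⊢I_
  data _⊢I_ : List Λ₀ → Λ₀ → Set where
    ax   : ∀ {Γ t} → t ∈ Γ → Γ ⊢I t
    LH   : ∀ {Γ} → Γ ⊢I L' · H
    LA   : ∀ {Γ} (β : Fin k) → Γ ⊢I L' · cn (A β)
    conv : ∀ {Γ t₁ t₂} → Γ ⊢I t₁ → t₁ =βη t₂ → Γ ⊢I t₂
    HI   : ∀ {Γ t} → Γ ⊢I t → Γ ⊢I H · t
    ΞE   : ∀ {Γ t₁ t₂ t₃} → Γ ⊢I Ξ' · t₁ · t₂ → Γ ⊢I t₁ · t₃ → Γ ⊢I t₂ · t₃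
    ΞI   : ∀ {Γ t₁ t₂} (τ : Ty k) (n : ℕ) →
           FreshIn τ n Γ → ¬ OccΛ τ n t₁ → ¬ OccΛ τ n t₂ →
           ((t₁ · fv τ n) ∷ Γ) ⊢I t₂ · fv τ n → Γ ⊢I L' · t₁ →
           Γ ⊢I Ξ' · t₁ · t₂
    HΞI  : ∀ {Γ t₁ t₂} (τ : Ty k) (n : ℕ) →
           FreshIn τ n Γ → ¬ OccΛ τ n t₁ → ¬ OccΛ τ n t₂ →
           ((t₁ · fv τ n) ∷ Γ) ⊢I H · (t₂ · fv τ n) → Γ ⊢I L' · t₁ →
           Γ ⊢I H · (Ξ' · t₁ · t₂)

  -- Γ ⊢_{I_0} t for an arbitrary set Γ (given as a predicate)
  _⊢I₀_ : (Λ₀ → Set) → Λ₀ → Set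
  P ⊢I₀ t = Σ (List Λ₀) λ Γ' → All P Γ' × Γ' ⊢I t

  pos : ∀ {Γ : List (Ty k)} {τ} → Γ ∋ τ → Fin (length Γ)
  pos here = zero
  pos (there i) = suc (pos i)

  ⟨_⟩ : ∀ {Γ τ} → Tm Con Γ τ → Λ Con (length Γ)
  ⟨ var {τ} n ⟩ = fv τ n
  ⟨ bvar i ⟩ = bv (pos i)
  ⟨ con c ⟩ = cn (cc c)
  ⟨ app t s ⟩ = ⟨ t ⟩ · ⟨ s ⟩
  ⟨ imp φ ψ ⟩ = ⟨ φ ⟩ ⊃' ⟨ ψ ⟩
  ⟨ all {τ} q φ ⟩ = Ξ' · AT τ · lam ⟨ φ ⟩

  ImgΔ : List (Form Con) → Λ₀ → Set
  ImgΔ Δ t = Σ (Form Con) λ ψ → ψ ∈ Δ × t ≡ ⟨ ψ ⟩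

  -- Γ(Δ), relative to a choice y β ∈ V_β (β ∈ B) of variables
  data GammaOf (Δ : List (Form Con)) (y : Fin k → ℕ) : Λ₀ → Set where
    g-var : ∀ τ n → FreeInList τ n Δ → GammaOf Δ y (AT τ · fv τ n)
    g-con : ∀ τ (c : Con τ) → GammaOf Δ y (AT τ · cn (cc c))
    g-LA  : ∀ β → GammaOf Δ y (L' · cn (A β))
    g-y   : ∀ β → GammaOf Δ y (AT (base β) · fv (base β) (y β))

  ValidChoice : List (Form Con) → (Fin k → ℕ) → Set
  ValidChoice Δ y = ∀ β → ¬ FreeInList (base β) (y β) Δ

module Submission where

-- PRED2₀ is interpreted in I₀ relative to an environment e sending every
-- named variable and every constant to a closed λ-term; ⟦ t ⟧ e is ⟨ t ⟩
-- with these replacements.  Two facts carry the argument: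
--   * typing: if the values of e have their expected types A_σ in a
--     context G, then every translated term of type τ has type A_τ in G;
--   * soundness: if Δ ⊢ φ, e is typed in G and every ⟦ ψ ⟧ e (ψ ∈ Δ) holds
--     in G, then ⟦ φ ⟧ e holds in G.
-- "Holds in G" is read stably (derivable from every extension of G), so
-- the ΞI rules can always pick an eigenvariable fresh for the context
-- actually in use.  For the theorem, e is the identity on the variables
-- and constants of Δ ∪ {φ} and sends all others to canonical inhabitants
-- built from the variables y β; then ⟦ ψ ⟧ e = ⟨ ψ ⟩ for ψ ∈ Δ ∪ {φ}, and
-- the finitely many typing assumptions used all lie in Γ(Δ ∪ {φ}).

open import Defs
open import Data.Nat using (ℕ; suc; _≤_; _⊔_)
import Data.Nat as ℕ
open import Data.Nat.Properties using (m≤m⊔n; m≤n⊔m; ≤-trans; ≤-refl; 1+n≰n)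
open import Data.Fin using (Fin; zero; suc)
open import Data.List using (List; []; _∷_; _++_; map; foldr; concatMap; length; allFin)
open import Data.List.Membership.Propositional using (_∈_; find; lose)
open import Data.List.Membership.Propositional.Properties
  using (∈-++⁺ˡ; ∈-++⁺ʳ; ∈-++⁻; ∈-map⁺; ∈-allFin; ∈-concatMap⁺; ∈-concatMap⁻)
import Data.List.Membership.DecPropositional as DecMembership
open import Data.List.Relation.Binary.Subset.Propositional using (_⊆_)
open import Data.List.Relation.Binary.Subset.Propositional.Properties using (∷⁺ʳ)
open import Data.List.Relation.Unary.Any using (here; there)
open import Data.List.Relation.Unary.All using (All; universal; tabulate)
import Data.List.Relation.Unary.All as All
open import Data.List.Relation.Unary.All.Properties using (++⁺; map⁺)
open import Data.Product using (Σ; _×_; _,_; proj₁; proj₂)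
open import Data.Product.Properties using (≡-dec)
open import Data.Sum using (_⊎_; inj₁; inj₂)
open import Data.Empty using (⊥-elim)
open import Relation.Nullary using (¬_; yes; no)
open import Relation.Nullary.Decidable using (via-injection)
open import Relation.Binary.Definitions using (DecidableEquality)
open import Relation.Binary.PropositionalEquality
open import Function.Bundles using (_↣_)
open Sub

-- Substitution algebra of de Bruijn λ-terms

module _ {k : ℕ} {Con : Ty k → Set} where

  liftRen : ∀ {m m'} → (Fin m → Fin m') → Fin (suc m) → Fin (suc m')
  liftRen = extRΛ {Con = Con}

  renΛ-cong : ∀ {m m'} {r r' : Fin m → Fin m'} → (∀ i → r i ≡ r' i) →
              (t : Λ Con m) → renΛ r t ≡ renΛ r' t
  renΛ-cong h (fv τ n) = refl
  renΛ-cong h (bv i) = cong bv (h i)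
  renΛ-cong h (cn c) = refl
  renΛ-cong h (t · u) = cong₂ _·_ (renΛ-cong h t) (renΛ-cong h u)
  renΛ-cong {r = r} {r'} h (lam t) = cong lam (renΛ-cong lifted t)
    where
    lifted : ∀ i → liftRen r i ≡ liftRen r' i
    lifted zero = refl
    lifted (suc i) = cong suc (h i)

  renΛ-renΛ : ∀ {m m' m''} (r : Fin m' → Fin m'') (r' : Fin m → Fin m') (t : Λ Con m) →
              renΛ r (renΛ r' t) ≡ renΛ (λ i → r (r' i)) t
  renΛ-renΛ r r' (fv τ n) = refl
  renΛ-renΛ r r' (bv i) = refl
  renΛ-renΛ r r' (cn c) = refl
  renΛ-renΛ r r' (t · u) = cong₂ _·_ (renΛ-renΛ r r' t) (renΛ-renΛ r r' u)
  renΛ-renΛ r r' (lam t) =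
    cong lam (trans (renΛ-renΛ (liftRen r) (liftRen r') t) (renΛ-cong lifted t))
    where
    lifted : ∀ i → liftRen r (liftRen r' i) ≡ liftRen (λ j → r (r' j)) i
    lifted zero = refl
    lifted (suc i) = refl

  renΛ-id : ∀ {m} (t : Λ Con m) → renΛ (λ i → i) t ≡ t
  renΛ-id (fv τ n) = refl
  renΛ-id (bv i) = refl
  renΛ-id (cn c) = refl
  renΛ-id (t · u) = cong₂ _·_ (renΛ-id t) (renΛ-id u)
  renΛ-id (lam t) = cong lam (trans (renΛ-cong lifted t) (renΛ-id t))
    where
    lifted : ∀ i → liftRen (λ j → j) i ≡ i
    lifted zero = refl
    lifted (suc i) = refl

  subΛ-cong : ∀ {m m'} {s s' : Fin m → Λ Con m'} → (∀ i → s i ≡ s' i) →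
              (t : Λ Con m) → subΛ s t ≡ subΛ s' t
  subΛ-cong h (fv τ n) = refl
  subΛ-cong h (bv i) = h i
  subΛ-cong h (cn c) = refl
  subΛ-cong h (t · u) = cong₂ _·_ (subΛ-cong h t) (subΛ-cong h u)
  subΛ-cong {s = s} {s'} h (lam t) = cong lam (subΛ-cong lifted t)
    where
    lifted : ∀ i → extSΛ s i ≡ extSΛ s' i
    lifted zero = refl
    lifted (suc i) = cong (renΛ suc) (h i)

  subΛ-renΛ : ∀ {m m' m''} (s : Fin m' → Λ Con m'') (r : Fin m → Fin m') (t : Λ Con m) →
              subΛ s (renΛ r t) ≡ subΛ (λ i → s (r i)) t
  subΛ-renΛ s r (fv τ n) = refl
  subΛ-renΛ s r (bv i) = refl
  subΛ-renΛ s r (cn c) = refl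
  subΛ-renΛ s r (t · u) = cong₂ _·_ (subΛ-renΛ s r t) (subΛ-renΛ s r u)
  subΛ-renΛ s r (lam t) =
    cong lam (trans (subΛ-renΛ (extSΛ s) (liftRen r) t) (subΛ-cong lifted t))
    where
    lifted : ∀ i → extSΛ s (liftRen r i) ≡ extSΛ (λ j → s (r j)) i
    lifted zero = refl
    lifted (suc i) = refl

  renΛ-subΛ : ∀ {m m' m''} (r : Fin m' → Fin m'') (s : Fin m → Λ Con m') (t : Λ Con m) →
              renΛ r (subΛ s t) ≡ subΛ (λ i → renΛ r (s i)) t
  renΛ-subΛ r s (fv τ n) = refl
  renΛ-subΛ r s (bv i) = refl
  renΛ-subΛ r s (cn c) = refl
  renΛ-subΛ r s (t · u) = cong₂ _·_ (renΛ-subΛ r s t) (renΛ-subΛ r s u)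
  renΛ-subΛ r s (lam t) =
    cong lam (trans (renΛ-subΛ (liftRen r) (extSΛ s) t) (subΛ-cong lifted t))
    where
    lifted : ∀ i → renΛ (liftRen r) (extSΛ s i) ≡ extSΛ (λ j → renΛ r (s j)) i
    lifted zero = refl
    lifted (suc i) = trans (renΛ-renΛ (liftRen r) suc (s i)) (sym (renΛ-renΛ suc r (s i)))

  subΛ-subΛ : ∀ {m m' m''} (s : Fin m' → Λ Con m'') (s' : Fin m → Λ Con m') (t : Λ Con m) →
              subΛ s (subΛ s' t) ≡ subΛ (λ i → subΛ s (s' i)) t
  subΛ-subΛ s s' (fv τ n) = refl
  subΛ-subΛ s s' (bv i) = refl
  subΛ-subΛ s s' (cn c) = refl
  subΛ-subΛ s s' (t · u) = cong₂ _·_ (subΛ-subΛ s s' t) (subΛ-subΛ s s' u)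
  subΛ-subΛ s s' (lam t) =
    cong lam (trans (subΛ-subΛ (extSΛ s) (extSΛ s') t) (subΛ-cong lifted t))
    where
    lifted : ∀ i → subΛ (extSΛ s) (extSΛ s' i) ≡ extSΛ (λ j → subΛ s (s' j)) i
    lifted zero = refl
    lifted (suc i) = trans (subΛ-renΛ (extSΛ s) suc (s' i)) (sym (renΛ-subΛ suc s (s' i)))

  subΛ-id : ∀ {m} (t : Λ Con m) → subΛ bv t ≡ t
  subΛ-id (fv τ n) = refl
  subΛ-id (bv i) = refl
  subΛ-id (cn c) = refl
  subΛ-id (t · u) = cong₂ _·_ (subΛ-id t) (subΛ-id u)
  subΛ-id (lam t) = cong lam (trans (subΛ-cong lifted t) (subΛ-id t))
    where
    lifted : ∀ i → extSΛ bv i ≡ bv i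
    lifted zero = refl
    lifted (suc i) = refl

  renΛ-as-subΛ : ∀ {m m'} (r : Fin m → Fin m') (t : Λ Con m) → subΛ (λ i → bv (r i)) t ≡ renΛ r t
  renΛ-as-subΛ r (fv τ n) = refl
  renΛ-as-subΛ r (bv i) = refl
  renΛ-as-subΛ r (cn c) = refl
  renΛ-as-subΛ r (t · u) = cong₂ _·_ (renΛ-as-subΛ r t) (renΛ-as-subΛ r u)
  renΛ-as-subΛ r (lam t) = cong lam (trans (subΛ-cong lifted t) (renΛ-as-subΛ (liftRen r) t))
    where
    lifted : ∀ i → extSΛ (λ j → bv (r j)) i ≡ bv (liftRen r i)
    lifted zero = refl
    lifted (suc i) = refl

  β-sub-shift : ∀ {m} (u t : Λ Con m) → subΛ (β-sub u) (renΛ suc t) ≡ t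
  β-sub-shift u t = trans (subΛ-renΛ (β-sub u) suc t) (subΛ-id t)

  extSΛ-shift : ∀ {m m'} (g : Fin m → Λ Con m') (t : Λ Con m) →
                subΛ (extSΛ g) (renΛ suc t) ≡ renΛ suc (subΛ g t)
  extSΛ-shift g t = trans (subΛ-renΛ (extSΛ g) suc t) (sym (renΛ-subΛ suc g t))

module _ {k : ℕ} {Con : Ty k → Set} where

  private
    noVar : ∀ {m} → Fin 0 → Fin m
    noVar ()

  weaken : ∀ {m} → Λ Con 0 → Λ Con m
  weaken = renΛ noVar

  renΛ-weaken : ∀ {m m'} (r : Fin m → Fin m') (c : Λ Con 0) → renΛ r (weaken c) ≡ weaken c
  renΛ-weaken r c = trans (renΛ-renΛ r noVar c) (renΛ-cong (λ ()) c)

  subΛ-weaken : ∀ {m m'} (s : Fin m → Λ Con m') (c : Λ Con 0) → subΛ s (weaken c) ≡ weaken c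
  subΛ-weaken s c =
    trans (subΛ-renΛ s noVar c)
          (trans (subΛ-cong {s' = λ i → bv (noVar i)} (λ ()) c) (renΛ-as-subΛ noVar c))

  weaken-id : (c : Λ Con 0) → weaken c ≡ c
  weaken-id c = trans (renΛ-cong (λ ()) c) (renΛ-id c)

  subΛ-weaken-closed : ∀ {m} (s : Fin m → Λ Con 0) (c : Λ Con 0) → subΛ s (weaken c) ≡ c
  subΛ-weaken-closed s c = trans (subΛ-weaken s c) (weaken-id c)

  subΛ-closed : (g : Fin 0 → Λ Con 0) (t : Λ Con 0) → subΛ g t ≡ t
  subΛ-closed g t = trans (subΛ-cong {s' = bv} (λ ()) t) (subΛ-id t)

  renΛ-AT : ∀ {m m'} (r : Fin m → Fin m') (σ : Ty k) → renΛ r (AT {Con = Con} σ) ≡ AT σ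
  renΛ-AT r o = refl
  renΛ-AT r (base β) = refl
  renΛ-AT r (β ⇒ τ) = cong (Fc · cn (A β) ·_) (renΛ-AT r τ)

  subΛ-AT : ∀ {m m'} (s : Fin m → Λ Con m') (σ : Ty k) → subΛ s (AT σ) ≡ AT σ
  subΛ-AT s o = refl
  subΛ-AT s (base β) = refl
  subΛ-AT s (β ⇒ τ) = cong (Fc · cn (A β) ·_) (subΛ-AT s τ)

-- β-laws of the combinators

module _ {k : ℕ} {Con : Ty k → Set} where

  ≡⇒βη : ∀ {m} {a b : Λ Con m} → a ≡ b → a =βη b
  ≡⇒βη refl = refl'

  K-β : ∀ {m} (a b : Λ Con m) → K · a · b =βη a
  K-β a b = trans' (app-cong βr refl') (trans' βr (≡⇒βη (β-sub-shift b a)))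

  H-β : ∀ {m} (a : Λ Con m) → H · a =βη L' · (K · a)
  H-β a = βr

  ⊃-β : ∀ {m} (a b : Λ Con m) → (a ⊃' b) =βη Ξ' · (K · a) · (K · b)
  ⊃-β a b =
    trans' (app-cong βr refl')
           (trans' βr (≡⇒βη (cong (λ z → Ξ' · (K · z) · (K · b)) (β-sub-shift b a))))

  compose-β : ∀ {m} (p f x : Λ Con m) → lam (renΛ suc p · (renΛ suc f · bv zero)) · x =βη p · (f · x)
  compose-β p f x =
    trans' βr (≡⇒βη (cong₂ (λ p' f' → p' · (f' · x)) (β-sub-shift x p) (β-sub-shift x f)))

  F-β : ∀ {m} (a b f : Λ Con m) → Fc · a · b · f =βη Ξ' · a · lam (renΛ suc b · (renΛ suc f · bv zero))
  F-β a b f =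
    trans' (app-cong (app-cong βr refl') refl')
           (trans' (app-cong βr refl')
                   (trans' βr (≡⇒βη (cong₂ (λ p q → Ξ' · p · lam (q · (renΛ suc f · bv zero))) a-restored b-restored))))
    where
    a-restored : subΛ (β-sub f) (subΛ (extSΛ (β-sub b)) (renΛ suc (renΛ suc a))) ≡ a
    a-restored =
      trans (cong (subΛ (β-sub f))
                  (trans (extSΛ-shift (β-sub b) (renΛ suc a)) (cong (renΛ suc) (β-sub-shift b a))))
            (β-sub-shift f a)
    b-restored : subΛ (extSΛ (β-sub f)) (renΛ suc (renΛ suc b)) ≡ renΛ suc b
    b-restored = trans (extSΛ-shift (β-sub f) (renΛ suc b)) (cong (renΛ suc) (β-sub-shift f b))

-- Stable derivability and fresh eigenvariables

module _ {k : ℕ} {Con : Ty k → Set} where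

  -- t is derivable from every finite extension of G.  Stability lets the
  -- ΞI rules choose an eigenvariable fresh for the context in actual use.
  Stable : List (Λ Con 0) → Λ Con 0 → Set
  Stable G t = ∀ G' → G ⊆ G' → G' ⊢I t

  stable-ax : ∀ {G t} → t ∈ G → Stable G t
  stable-ax t∈G G' G⊆G' = ax (G⊆G' t∈G)

  stable-conv : ∀ {G a b} → Stable G a → a =βη b → Stable G b
  stable-conv ⊢a a=b G' G⊆G' = conv (⊢a G' G⊆G') a=b

  stable-mono : ∀ {G G' t} → G ⊆ G' → Stable G t → Stable G' t
  stable-mono G⊆G' ⊢t G'' G'⊆G'' = ⊢t G'' (λ p → G'⊆G'' (G⊆G' p))

  stable-ΞE : ∀ {G a b c} → Stable G (Ξ' · a · b) → Stable G (a · c) → Stable G (b · c)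
  stable-ΞE ⊢Ξab ⊢ac G' G⊆G' = ΞE (⊢Ξab G' G⊆G') (⊢ac G' G⊆G')

  stable-L : ∀ {G τ} → QTy τ → Stable G (L' · AT {Con = Con} τ)
  stable-L qo G' _ = LH
  stable-L (qb β) G' _ = LA β

  maxVar : ∀ {m} → Λ Con m → ℕ
  maxVar (fv τ n) = n
  maxVar (bv i) = 0
  maxVar (cn c) = 0
  maxVar (t · u) = maxVar t ⊔ maxVar u
  maxVar (lam t) = maxVar t

  occ≤maxVar : ∀ {m τ n} {t : Λ Con m} → OccΛ τ n t → n ≤ maxVar t
  occ≤maxVar o-fv = ≤-refl
  occ≤maxVar (o-·l {t = t} {u} p) = ≤-trans (occ≤maxVar p) (m≤m⊔n (maxVar t) (maxVar u))
  occ≤maxVar (o-·r {t = t} {u} p) = ≤-trans (occ≤maxVar p) (m≤n⊔m (maxVar t) (maxVar u))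
  occ≤maxVar (o-lam p) = occ≤maxVar p

  maxVarList : List (Λ Con 0) → ℕ
  maxVarList = foldr (λ t b → maxVar t ⊔ b) 0

  occ≤maxVarList : ∀ {G t τ n} → t ∈ G → OccΛ τ n t → n ≤ maxVarList G
  occ≤maxVarList {t ∷ G} (here refl) occ = ≤-trans (occ≤maxVar occ) (m≤m⊔n _ (maxVarList G))
  occ≤maxVarList {u ∷ G} (there p) occ = ≤-trans (occ≤maxVarList p occ) (m≤n⊔m (maxVar u) _)

  fresh : ∀ G {t τ} → t ∈ G → ¬ OccΛ τ (suc (maxVarList G)) t
  fresh G p occ = 1+n≰n (occ≤maxVarList p occ)

  stable-ΞI : ∀ {G t₁ t₂} (τ : Ty k) →
              (∀ n → Stable ((t₁ · fv τ n) ∷ G) (t₂ · fv τ n)) → Stable G (L' · t₁) →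
              Stable G (Ξ' · t₁ · t₂)
  stable-ΞI {G} {t₁} {t₂} τ body ⊢Lt₁ G' G⊆G' =
    ΞI τ n (λ t p → fresh G'' (there (there p))) (fresh G'' (here refl)) (fresh G'' (there (here refl)))
       (body n _ (∷⁺ʳ _ G⊆G')) (⊢Lt₁ G' G⊆G')
    where
    G'' = t₁ ∷ t₂ ∷ G'
    n = suc (maxVarList G'')

  stable-HΞI : ∀ {G t₁ t₂} (τ : Ty k) →
               (∀ n → Stable ((t₁ · fv τ n) ∷ G) (H · (t₂ · fv τ n))) → Stable G (L' · t₁) →
               Stable G (H · (Ξ' · t₁ · t₂))
  stable-HΞI {G} {t₁} {t₂} τ body ⊢Lt₁ G' G⊆G' =
    HΞI τ n (λ t p → fresh G'' (there (there p))) (fresh G'' (here refl)) (fresh G'' (there (here refl)))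
        (body n _ (∷⁺ʳ _ G⊆G')) (⊢Lt₁ G' G⊆G')
    where
    G'' = t₁ ∷ t₂ ∷ G'
    n = suc (maxVarList G'')

-- Translation relative to an environment

module _ {k : ℕ} {Con : Ty k → Set} where

  record Env : Set where
    field
      varVal : Ty k → ℕ → Λ Con 0
      conVal : ∀ {τ} → Con τ → Λ Con 0
  open Env public

  slot : ∀ {Γ : List (Ty k)} {τ} → Γ ∋ τ → Fin (length Γ)
  slot = pos {Con = Con}

  infix 25 ⟦_⟧_
  ⟦_⟧_ : ∀ {Γ τ} → Tm Con Γ τ → Env → Λ Con (length Γ)
  ⟦ var {τ} n ⟧ e = weaken (varVal e τ n)
  ⟦ bvar i ⟧ e = bv (slot i)
  ⟦ con c ⟧ e = weaken (conVal e c)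
  ⟦ app t s ⟧ e = ⟦ t ⟧ e · ⟦ s ⟧ e
  ⟦ imp φ ψ ⟧ e = ⟦ φ ⟧ e ⊃' ⟦ ψ ⟧ e
  ⟦ all {τ} q φ ⟧ e = Ξ' · AT τ · lam (⟦ φ ⟧ e)

  ⟦⟧-ren : ∀ {Γ Γ'} (r : Ren {Con = Con} Γ Γ') (r' : Fin (length Γ) → Fin (length Γ')) →
           (∀ {τ} (i : Γ ∋ τ) → slot (r i) ≡ r' (slot i)) →
           (e : Env) → ∀ {τ} (u : Tm Con Γ τ) → ⟦ ren r u ⟧ e ≡ renΛ r' (⟦ u ⟧ e)
  ⟦⟧-ren r r' h e (var {τ} n) = sym (renΛ-weaken r' (varVal e τ n))
  ⟦⟧-ren r r' h e (bvar i) = cong bv (h i)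
  ⟦⟧-ren r r' h e (con c) = sym (renΛ-weaken r' (conVal e c))
  ⟦⟧-ren r r' h e (app t u) = cong₂ _·_ (⟦⟧-ren r r' h e t) (⟦⟧-ren r r' h e u)
  ⟦⟧-ren r r' h e (imp t u) = cong₂ _⊃'_ (⟦⟧-ren r r' h e t) (⟦⟧-ren r r' h e u)
  ⟦⟧-ren {Γ} r r' h e (all {σ} q φ) =
    cong₂ (λ a b → Ξ' · a · lam b) (sym (renΛ-AT r' σ)) (⟦⟧-ren (extR r) (liftRen {Con = Con} r') lifted e φ)
    where
    lifted : ∀ {τ} (i : (σ ∷ Γ) ∋ τ) → slot (extR {Con = Con} r i) ≡ liftRen {Con = Con} r' (slot i)
    lifted here = refl
    lifted (there i) = cong suc (h i)

  ⟦⟧-sub : ∀ {Γ Γ' m} (s : Sub {Con = Con} Γ Γ') (g : Fin (length Γ') → Λ Con m)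
             (h : Fin (length Γ) → Λ Con m) (e e' : Env) →
           (∀ {τ} (c : Con τ) → conVal e c ≡ conVal e' c) →
           (∀ {τ} (i : Γ ∋ τ) → subΛ g (⟦ ρ s i ⟧ e) ≡ h (slot i)) →
           (∀ σ n → subΛ g (⟦ ν s σ n ⟧ e) ≡ weaken (varVal e' σ n)) →
           ∀ {τ} (u : Tm Con Γ τ) → subΛ g (⟦ sub s u ⟧ e) ≡ subΛ h (⟦ u ⟧ e')
  ⟦⟧-sub s g h e e' hc hρ hν (var {σ} n) = trans (hν σ n) (sym (subΛ-weaken h (varVal e' σ n)))
  ⟦⟧-sub s g h e e' hc hρ hν (bvar i) = hρ i
  ⟦⟧-sub s g h e e' hc hρ hν (con c) =
    trans (subΛ-weaken g (conVal e c)) (trans (cong weaken (hc c)) (sym (subΛ-weaken h (conVal e' c))))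
  ⟦⟧-sub s g h e e' hc hρ hν (app t u) =
    cong₂ _·_ (⟦⟧-sub s g h e e' hc hρ hν t) (⟦⟧-sub s g h e e' hc hρ hν u)
  ⟦⟧-sub s g h e e' hc hρ hν (imp t u) =
    cong₂ _⊃'_ (⟦⟧-sub s g h e e' hc hρ hν t) (⟦⟧-sub s g h e e' hc hρ hν u)
  ⟦⟧-sub {Γ} {Γ'} s g h e e' hc hρ hν (all {σ} q φ) =
    cong₂ (λ a b → Ξ' · a · lam b) (trans (subΛ-AT g σ) (sym (subΛ-AT h σ)))
          (⟦⟧-sub (extS s) (extSΛ g) (extSΛ h) e e' hc liftedρ liftedν φ)
    where
    shifted : ∀ {τ} (t : Tm Con Γ' τ) → subΛ (extSΛ g) (⟦ ren there t ⟧ e) ≡ renΛ suc (subΛ g (⟦ t ⟧ e))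
    shifted t = trans (cong (subΛ (extSΛ g)) (⟦⟧-ren there suc (λ _ → refl) e t)) (extSΛ-shift g (⟦ t ⟧ e))
    liftedρ : ∀ {τ} (i : (σ ∷ Γ) ∋ τ) → subΛ (extSΛ g) (⟦ ρ (extS s) i ⟧ e) ≡ extSΛ h (slot i)
    liftedρ here = refl
    liftedρ (there i) = trans (shifted (ρ s i)) (cong (renΛ suc) (hρ i))
    liftedν : ∀ σ' n → subΛ (extSΛ g) (⟦ ν (extS s) σ' n ⟧ e) ≡ weaken (varVal e' σ' n)
    liftedν σ' n =
      trans (shifted (ν s σ' n)) (trans (cong (renΛ suc) (hν σ' n)) (renΛ-weaken suc (varVal e' σ' n)))

  ⟦⟧-inst : (e : Env) {τ : Ty k} (φ : Tm Con (τ ∷ []) o) (t : Tm Con [] τ) →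
            ⟦ inst φ t ⟧ e ≡ subΛ (β-sub (⟦ t ⟧ e)) (⟦ φ ⟧ e)
  ⟦⟧-inst e φ t =
    trans (sym (subΛ-closed (λ ()) (⟦ inst φ t ⟧ e)))
          (⟦⟧-sub _ (λ ()) (β-sub (⟦ t ⟧ e)) e e (λ c → refl)
                  (λ { here → subΛ-closed (λ ()) (⟦ t ⟧ e) ; (there ()) })
                  (λ σ n → subΛ-weaken (λ ()) (varVal e σ n)) φ)

  update : Env → Ty k → ℕ → Λ Con 0 → Env
  update e τ n u = record { varVal = updated ; conVal = conVal e }
    where
    updated : Ty k → ℕ → Λ Con 0
    updated σ m with σ ≟Ty τ | m ℕ.≟ n
    ... | yes refl | yes _ = u
    ... | _ | _ = varVal e σ m

  ⟦⟧-close : (e : Env) (τ : Ty k) (n : ℕ) (φ : Form Con) (u : Λ Con 0) →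
             lam (⟦ close τ n φ ⟧ e) · u =βη ⟦ φ ⟧ (update e τ n u)
  ⟦⟧-close e τ n φ u =
    trans' βr (≡⇒βη (trans (⟦⟧-sub _ (β-sub u) (λ ()) e (update e τ n u) (λ c → refl) (λ ()) closed φ)
                           (subΛ-closed (λ ()) _)))
    where
    closed : ∀ σ m → subΛ (β-sub u) (⟦ closeν τ n σ m ⟧ e) ≡ weaken (varVal (update e τ n u) σ m)
    closed σ m with σ ≟Ty τ | m ℕ.≟ n
    ... | yes refl | yes refl = sym (weaken-id u)
    ... | yes refl | no _ = subΛ-weaken (β-sub u) (varVal e σ m)
    ... | no _ | _ = subΛ-weaken (β-sub u) (varVal e σ m)

  vars : ∀ {Γ σ} → Tm Con Γ σ → List (Ty k × ℕ)
  vars (var {σ} n) = (σ , n) ∷ []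
  vars (bvar i) = []
  vars (con c) = []
  vars (app t u) = vars t ++ vars u
  vars (imp φ ψ) = vars φ ++ vars ψ
  vars (all q φ) = vars φ

  consts : ∀ {Γ σ} → Tm Con Γ σ → List (Σ (Ty k) Con)
  consts (var n) = []
  consts (bvar i) = []
  consts (con {σ} c) = (σ , c) ∷ []
  consts (app t u) = consts t ++ consts u
  consts (imp φ ψ) = consts φ ++ consts ψ
  consts (all q φ) = consts φ

  vars-occ : ∀ {Γ σ τ n} (u : Tm Con Γ σ) → (τ , n) ∈ vars u → Occ τ n u
  vars-occ (var m) (here refl) = o-var
  vars-occ (app t u) p with ∈-++⁻ (vars t) p
  ... | inj₁ q = o-appl (vars-occ t q)
  ... | inj₂ q = o-appr (vars-occ u q)
  vars-occ (imp t u) p with ∈-++⁻ (vars t) p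
  ... | inj₁ q = o-impl (vars-occ t q)
  ... | inj₂ q = o-impr (vars-occ u q)
  vars-occ (all q φ) p = o-all (vars-occ φ p)

  ⟦⟧-agree : ∀ {Γ σ} (e e' : Env) (u : Tm Con Γ σ) →
             (∀ τ n → (τ , n) ∈ vars u → varVal e τ n ≡ varVal e' τ n) →
             (∀ τ (c : Con τ) → (τ , c) ∈ consts u → conVal e c ≡ conVal e' c) →
             ⟦ u ⟧ e ≡ ⟦ u ⟧ e'
  ⟦⟧-agree e e' (var n) hv hc = cong weaken (hv _ _ (here refl))
  ⟦⟧-agree e e' (bvar i) hv hc = refl
  ⟦⟧-agree e e' (con c) hv hc = cong weaken (hc _ _ (here refl))
  ⟦⟧-agree e e' (app t u) hv hc =
    cong₂ _·_ (⟦⟧-agree e e' t (λ τ n p → hv τ n (∈-++⁺ˡ p)) (λ τ c p → hc τ c (∈-++⁺ˡ p)))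
              (⟦⟧-agree e e' u (λ τ n p → hv τ n (∈-++⁺ʳ (vars t) p)) (λ τ c p → hc τ c (∈-++⁺ʳ (consts t) p)))
  ⟦⟧-agree e e' (imp t u) hv hc =
    cong₂ _⊃'_ (⟦⟧-agree e e' t (λ τ n p → hv τ n (∈-++⁺ˡ p)) (λ τ c p → hc τ c (∈-++⁺ˡ p)))
               (⟦⟧-agree e e' u (λ τ n p → hv τ n (∈-++⁺ʳ (vars t) p)) (λ τ c p → hc τ c (∈-++⁺ʳ (consts t) p)))
  ⟦⟧-agree e e' (all {σ} q φ) hv hc = cong (λ b → Ξ' · AT σ · lam b) (⟦⟧-agree e e' φ hv hc)

-- Typing and soundness of the translation

module _ {k : ℕ} {Con : Ty k → Set} where

  TypedEnv : Env {Con = Con} → List (Λ Con 0) → Set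
  TypedEnv e G = (∀ σ n → Stable G (AT σ · varVal e σ n)) × (∀ σ (c : Con σ) → Stable G (AT σ · conVal e c))

  typedEnv-mono : ∀ {e G G'} → G ⊆ G' → TypedEnv e G → TypedEnv e G'
  typedEnv-mono G⊆G' (typedVar , typedCon) =
    (λ σ n → stable-mono G⊆G' (typedVar σ n)) , (λ σ c → stable-mono G⊆G' (typedCon σ c))

  typedEnv-update : ∀ {e G} τ n m → TypedEnv e G → TypedEnv (update e τ n (fv τ m)) ((AT τ · fv τ m) ∷ G)
  typedEnv-update {e} {G} τ n m (typedVar , typedCon) = typedVar' , (λ σ c → stable-mono there (typedCon σ c))
    where
    typedVar' : ∀ σ l → Stable ((AT τ · fv τ m) ∷ G) (AT σ · varVal (update e τ n (fv τ m)) σ l)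
    typedVar' σ l with σ ≟Ty τ | l ℕ.≟ n
    ... | yes refl | yes _ = stable-ax (here refl)
    ... | yes refl | no _ = stable-mono there (typedVar σ l)
    ... | no _ | _ = stable-mono there (typedVar σ l)

  ⟦⟧-update-fresh : ∀ {Γ σ} e τ n u (ψ : Tm Con Γ σ) → ¬ Occ τ n ψ → ⟦ ψ ⟧ (update e τ n u) ≡ ⟦ ψ ⟧ e
  ⟦⟧-update-fresh e τ n u ψ notOcc = ⟦⟧-agree _ _ ψ agree (λ _ _ _ → refl)
    where
    agree : ∀ σ m → (σ , m) ∈ vars ψ → varVal (update e τ n u) σ m ≡ varVal e σ m
    agree σ m p with σ ≟Ty τ | m ℕ.≟ n
    ... | yes refl | yes refl = ⊥-elim (notOcc (vars-occ ψ p))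
    ... | yes refl | no _ = refl
    ... | no _ | _ = refl

  extend : ∀ {m} → Λ Con 0 → (Fin m → Λ Con 0) → Fin (suc m) → Λ Con 0
  extend x g zero = x
  extend x g (suc i) = g i

  typing : ∀ {Γ τ} (u : Tm Con Γ τ) (g : Fin (length Γ) → Λ Con 0) (e : Env) (G : List (Λ Con 0)) →
           TypedEnv e G → (∀ {σ} (i : Γ ∋ σ) → Stable G (AT σ · g (slot {Con = Con} i))) →
           Stable G (AT τ · subΛ g (⟦ u ⟧ e))
  typing (var {σ} n) g e G te tg =
    stable-conv (proj₁ te σ n) (≡⇒βη (cong (AT σ ·_) (sym (subΛ-weaken-closed g (varVal e σ n)))))
  typing (bvar i) g e G te tg = tg i
  typing (con {σ} c) g e G te tg =
    stable-conv (proj₂ te σ c) (≡⇒βη (cong (AT σ ·_) (sym (subΛ-weaken-closed g (conVal e c)))))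
  typing (app t s) g e G te tg =
    stable-conv (stable-ΞE (stable-conv (typing t g e G te tg) (F-β _ _ _)) (typing s g e G te tg))
                (compose-β _ _ _)
  typing (imp φ ψ) g e G te tg =
    stable-conv (stable-HΞI o body (stable-conv (typing φ g e G te tg) (H-β _)))
                (app-cong refl' (sym' (⊃-β _ _)))
    where
    body : ∀ n → Stable ((K · subΛ g (⟦ φ ⟧ e) · fv o n) ∷ G) (H · (K · subΛ g (⟦ ψ ⟧ e) · fv o n))
    body n = stable-conv (typing ψ g e _ (typedEnv-mono there te) (λ i → stable-mono there (tg i)))
                         (app-cong refl' (sym' (K-β _ _)))
  typing {Γ} (all {σ} q φ) g e G te tg =
    stable-conv (stable-HΞI σ body (stable-L q))
                (app-cong refl' (app-cong (app-cong refl' (≡⇒βη (sym (subΛ-AT g σ)))) refl'))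
    where
    body : ∀ n → Stable ((AT σ · fv σ n) ∷ G) (H · (lam (subΛ (extSΛ g) (⟦ φ ⟧ e)) · fv σ n))
    body n = stable-conv (typing φ (extend (fv σ n) g) e _ (typedEnv-mono there te) tg')
                         (app-cong refl' (sym' (trans' βr (≡⇒βη instantiated))))
      where
      instantiated : subΛ (β-sub (fv σ n)) (subΛ (extSΛ g) (⟦ φ ⟧ e)) ≡ subΛ (extend (fv σ n) g) (⟦ φ ⟧ e)
      instantiated = trans (subΛ-subΛ (β-sub (fv σ n)) (extSΛ g) (⟦ φ ⟧ e)) (subΛ-cong pointwise (⟦ φ ⟧ e))
        where
        pointwise : ∀ i → subΛ (β-sub (fv σ n)) (extSΛ g i) ≡ extend (fv σ n) g i
        pointwise zero = refl
        pointwise (suc i) = β-sub-shift (fv σ n) (g i)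
      tg' : ∀ {σ'} (i : (σ ∷ Γ) ∋ σ') → Stable ((AT σ · fv σ n) ∷ G) (AT σ' · extend (fv σ n) g (slot {Con = Con} i))
      tg' here = stable-ax (here refl)
      tg' (there i) = stable-mono there (tg i)

  typing₀ : ∀ {τ} (u : Tm Con [] τ) (e : Env) (G : List (Λ Con 0)) → TypedEnv e G → Stable G (AT τ · ⟦ u ⟧ e)
  typing₀ {τ} u e G te =
    stable-conv (typing u (λ ()) e G te (λ ())) (≡⇒βη (cong (AT τ ·_) (subΛ-closed (λ ()) (⟦ u ⟧ e))))

  sound : ∀ {Δ φ} → Δ ⊢P φ → (e : Env) (G : List (Λ Con 0)) → TypedEnv e G →
          (∀ {ψ} → ψ ∈ Δ → Stable G (⟦ ψ ⟧ e)) → Stable G (⟦ φ ⟧ e)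
  sound (ax p) e G te hyps = hyps p
  sound {Δ} (⊃I {φ = φ} {ψ} d) e G te hyps =
    stable-conv (stable-ΞI o body (stable-conv (typing₀ φ e G te) (H-β _))) (sym' (⊃-β _ _))
    where
    body : ∀ n → Stable ((K · ⟦ φ ⟧ e · fv o n) ∷ G) (K · ⟦ ψ ⟧ e · fv o n)
    body n = stable-conv (sound d e _ (typedEnv-mono there te) hyps') (sym' (K-β _ _))
      where
      hyps' : ∀ {χ} → χ ∈ (φ ∷ Δ) → Stable ((K · ⟦ φ ⟧ e · fv o n) ∷ G) (⟦ χ ⟧ e)
      hyps' (here refl) = stable-conv (stable-ax (here refl)) (K-β _ _)
      hyps' (there p) = stable-mono there (hyps p)
  sound (⊃E {φ = φ} d₁ d₂) e G te hyps =
    stable-conv (stable-ΞE {c = ⟦ φ ⟧ e} (stable-conv (sound d₁ e G te hyps) (⊃-β _ _))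
                                        (stable-conv (sound d₂ e G te hyps) (sym' (K-β _ _))))
                (K-β _ _)
  sound {Δ} (∀I {φ = φ} {τ} q n notFree d) e G te hyps = stable-ΞI τ body (stable-L q)
    where
    body : ∀ m → Stable ((AT τ · fv τ m) ∷ G) (lam (⟦ close τ n φ ⟧ e) · fv τ m)
    body m = stable-conv (sound d (update e τ n (fv τ m)) _ (typedEnv-update τ n m te) hyps')
                         (sym' (⟦⟧-close e τ n φ (fv τ m)))
      where
      hyps' : ∀ {ψ} → ψ ∈ Δ → Stable ((AT τ · fv τ m) ∷ G) (⟦ ψ ⟧ update e τ n (fv τ m))
      hyps' {ψ} p =
        stable-mono there
          (subst (Stable G) (sym (⟦⟧-update-fresh e τ n _ ψ (λ occ → notFree (ψ , p , occ)))) (hyps p))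
  sound (∀E {φ = φ} d t) e G te hyps =
    stable-conv (stable-ΞE (sound d e G te hyps) (typing₀ t e G te))
                (trans' βr (≡⇒βη (sym (⟦⟧-inst e φ t))))

-- The environment and typing context for a finite set of formulas Θ

module EnvironmentFor {k : ℕ} {Con : Ty k → Set} (conCode : ∀ τ → Con τ ↣ ℕ)
                   (Θ : List (Form Con)) (y : Fin k → ℕ) where

  -- variables and constants have decidable equality (constants via their codes)
  _≟Var_ : DecidableEquality (Ty k × ℕ)
  _≟Var_ = ≡-dec _≟Ty_ ℕ._≟_

  _≟Con_ : DecidableEquality (Σ (Ty k) Con)
  _≟Con_ = ≡-dec _≟Ty_ (λ {τ} → via-injection (conCode τ) ℕ._≟_)

  open DecMembership _≟Var_ using () renaming (_∈?_ to _∈Var?_)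
  open DecMembership _≟Con_ using () renaming (_∈?_ to _∈Con?_)

  varsΘ : List (Ty k × ℕ)
  varsΘ = concatMap vars Θ

  constsΘ : List (Σ (Ty k) Con)
  constsΘ = concatMap consts Θ

  varsΘ-free : ∀ {τ n} → (τ , n) ∈ varsΘ → FreeInList τ n Θ
  varsΘ-free p with find (∈-concatMap⁻ vars p)
  ... | ψ , ψ∈Θ , q = ψ , ψ∈Θ , vars-occ ψ q

  inhabitant : Ty k → Λ Con 0
  inhabitant o = L' · H
  inhabitant (base β) = fv (base β) (y β)
  inhabitant (β ⇒ τ) = K · inhabitant τ

  inhabitant-typed : ∀ {G} → (∀ β → Stable G (cn (A β) · fv (base β) (y β))) →
                     ∀ σ → Stable G (AT σ · inhabitant σ)
  inhabitant-typed typedY o G' _ = HI LH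
  inhabitant-typed typedY (base β) = typedY β
  inhabitant-typed {G} typedY (β ⇒ τ) =
    stable-conv (stable-ΞI (base β) body (λ _ _ → LA β)) (sym' (F-β _ _ _))
    where
    body : ∀ n → Stable ((cn (A β) · fv (base β) n) ∷ G)
                        (lam (renΛ suc (AT τ) · (renΛ suc (K · inhabitant τ) · bv zero)) · fv (base β) n)
    body n = stable-conv (stable-mono there (inhabitant-typed typedY τ))
               (sym' (trans' (compose-β (AT τ) (K · inhabitant τ) (fv (base β) n)) (app-cong refl' (K-β _ _))))

  envΘ : Env {Con = Con}
  envΘ = record { varVal = varValΘ ; conVal = conValΘ }
    where
    varValΘ : Ty k → ℕ → Λ Con 0
    varValΘ σ m with (σ , m) ∈Var? varsΘ
    ... | yes _ = fv σ m
    ... | no _ = inhabitant σ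
    conValΘ : ∀ {σ} → Con σ → Λ Con 0
    conValΘ {σ} c with (σ , c) ∈Con? constsΘ
    ... | yes _ = cn (cc c)
    ... | no _ = inhabitant σ

  identityEnv : Env {Con = Con}
  identityEnv = record { varVal = fv ; conVal = λ c → cn (cc c) }

  ⟦⟧-identityEnv : ∀ {Γ σ} (u : Tm Con Γ σ) → ⟦ u ⟧ identityEnv ≡ ⟨ u ⟩
  ⟦⟧-identityEnv (var n) = refl
  ⟦⟧-identityEnv (bvar i) = refl
  ⟦⟧-identityEnv (con c) = refl
  ⟦⟧-identityEnv (app t u) = cong₂ _·_ (⟦⟧-identityEnv t) (⟦⟧-identityEnv u)
  ⟦⟧-identityEnv (imp t u) = cong₂ _⊃'_ (⟦⟧-identityEnv t) (⟦⟧-identityEnv u)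
  ⟦⟧-identityEnv (all {σ} q χ) = cong (λ b → Ξ' · AT σ · lam b) (⟦⟧-identityEnv χ)

  ⟦⟧-envΘ : ∀ {ψ} → ψ ∈ Θ → ⟦ ψ ⟧ envΘ ≡ ⟨ ψ ⟩
  ⟦⟧-envΘ {ψ} ψ∈Θ = trans (⟦⟧-agree envΘ identityEnv ψ onVars onConsts) (⟦⟧-identityEnv ψ)
    where
    onVars : ∀ τ n → (τ , n) ∈ vars ψ → varVal envΘ τ n ≡ fv τ n
    onVars τ n p with (τ , n) ∈Var? varsΘ
    ... | yes _ = refl
    ... | no notIn = ⊥-elim (notIn (∈-concatMap⁺ vars (lose ψ∈Θ p)))
    onConsts : ∀ τ (c : Con τ) → (τ , c) ∈ consts ψ → conVal envΘ c ≡ cn (cc c)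
    onConsts τ c p with (τ , c) ∈Con? constsΘ
    ... | yes _ = refl
    ... | no notIn = ⊥-elim (notIn (∈-concatMap⁺ consts (lose ψ∈Θ p)))

  varTyping : Ty k × ℕ → Λ Con 0
  varTyping (τ , n) = AT τ · fv τ n

  conTyping : Σ (Ty k) Con → Λ Con 0
  conTyping (τ , c) = AT τ · cn (cc c)

  yTyping : Fin k → Λ Con 0
  yTyping β = AT (base β) · fv (base β) (y β)

  typingCtx : List (Λ Con 0)
  typingCtx = map varTyping varsΘ ++ map conTyping constsΘ ++ map yTyping (allFin k)

  typingCtx-⊆Γ : All (GammaOf Θ y) typingCtx
  typingCtx-⊆Γ =
    ++⁺ (map⁺ {f = varTyping} (tabulate (λ {(τ , n)} p → g-var τ n (varsΘ-free p))))
        (++⁺ (map⁺ (universal (λ (τ , c) → g-con τ c) constsΘ))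
             (map⁺ (universal g-y (allFin k))))

  envΘ-typed : TypedEnv envΘ typingCtx
  envΘ-typed = typedVar , typedCon
    where
    typedY : ∀ β → Stable typingCtx (yTyping β)
    typedY β = stable-ax (∈-++⁺ʳ (map varTyping varsΘ) (∈-++⁺ʳ (map conTyping constsΘ)
                                                                (∈-map⁺ yTyping (∈-allFin β))))
    typedVar : ∀ σ m → Stable typingCtx (AT σ · varVal envΘ σ m)
    typedVar σ m with (σ , m) ∈Var? varsΘ
    ... | yes p = stable-ax (∈-++⁺ˡ (∈-map⁺ varTyping p))
    ... | no _ = inhabitant-typed typedY σ
    typedCon : ∀ σ (c : Con σ) → Stable typingCtx (AT σ · conVal envΘ c)
    typedCon σ c with (σ , c) ∈Con? constsΘ
    ... | yes p = stable-ax (∈-++⁺ʳ (map varTyping varsΘ) (∈-++⁺ˡ (∈-map⁺ conTyping p)))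
    ... | no _ = inhabitant-typed typedY σ

mainTheorem2 : (k : ℕ) (Con : Ty k → Set) → (∀ τ → Con τ ↣ ℕ) →
    (Δ : List (Form Con)) (φ : Form Con) →
    Δ ⊢P φ →
    (y : Fin k → ℕ) → ValidChoice (φ ∷ Δ) y →
    (λ t → ImgΔ Δ t ⊎ GammaOf (φ ∷ Δ) y t) ⊢I₀ ⟨ φ ⟩
mainTheorem2 k Con conCode Δ φ d y _ =
  G , G-allowed , subst (G ⊢I_) (⟦⟧-envΘ (here refl)) (sound d envΘ G typed hyps G (λ p → p))
  where
  open EnvironmentFor conCode (φ ∷ Δ) y
  G : List (Λ Con 0)
  G = map ⟨_⟩ Δ ++ typingCtx
  G-allowed : All (λ t → ImgΔ Δ t ⊎ GammaOf (φ ∷ Δ) y t) G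
  G-allowed = ++⁺ (map⁺ (tabulate (λ {ψ} p → inj₁ (ψ , p , refl)))) (All.map inj₂ typingCtx-⊆Γ)
  typed : TypedEnv envΘ G
  typed = typedEnv-mono (∈-++⁺ʳ (map ⟨_⟩ Δ)) envΘ-typed
  hyps : ∀ {ψ} → ψ ∈ Δ → Stable G (⟦ ψ ⟧ envΘ)
  hyps {ψ} p = subst (Stable G) (sym (⟦⟧-envΘ (there p))) (stable-ax (∈-++⁺ˡ (∈-map⁺ ⟨_⟩ p)))
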